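{- Let $T$ be a decomposition tree and let $v$ be an internal node of $T$ with left child $v_l$ and right child $v_r$. Then $\hat\gamma_p(v)=\hat\gamma_p(v_l)+\hat\gamma_p(v_r)$ if $v$ is labeled $\odot$, and $\hat\gamma_p(v)=\hat\gamma_0(v)+2\cdot \widehat{mty}_{pr}(v)$ if $v$ is labeled $\otimes$ or $\oplus$.
   Context: All graphs are finite, simple and undirected. For a graph $H$ and $S\subseteq V(H)$, $N_H[S]$ is the closed neighbourhood of $S$ in $H$ and $H[S]$ the induced subgraph; a graph with no vertices is regarded as having a (empty) perfect matching. A decomposition tree is a rooted tree $T$ in which every internal node has exactly two children, a left child $v_l$ and a right child $v_r$, and carries one of the labels $\otimes$ (true twin), $\odot$ (false twin), $\oplus$ (attachment). To each node $v$ are associated a graph $\hat G(v)$ and a twin set $\hat{TS}(v)\subseteq V(\hat G(v))$: for a leaf, $\hat G(v)$ is a single vertex $x$ (distinct leaves giving distinct vertices) and $\hat{TS}(v)=\{x\}$; for an internal node $v$, $V(\hat G(v))=V(\hat G(v_l))\cup V(\hat G(v_r))$ and: if $v$ is labeled $\otimes$, $E(\hat G(v))=E(\hat G(v_l))\cup E(\hat G(v_r))\cup\{xy: x\in \hat{TS}(v_l), y\in\hat{TS}(v_r)\}$ and $\hat{TS}(v)=\hat{TS}(v_l)\cup\hat{TS}(v_r)$; if labeled $\odot$, $E(\hat G(v))=E(\hat G(v_l))\cup E(\hat G(v_r))$ and $\hat{TS}(v)=\hat{TS}(v_l)\cup\hat{TS}(v_r)$; if labeled $\oplus$, the edge set is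 as for $\otimes$ and $\hat{TS}(v)=\hat{TS}(v_l)$. For $0\le k\le|\hat{TS}(v)|$, $\hat\gamma_k(v)$ is the minimum of $|S|$ over all $S\subseteq V(\hat G(v))$ with $V(\hat G(v))\setminus \hat{TS}(v)\subseteq N_{\hat G(v)}[S]$ for which there is $X\subseteq S\cap\hat{TS}(v)$, $|X|=k$, such that $\hat G(v)[S\setminus X]$ has a perfect matching; $\hat D_k(v)$ is the family of such sets $S$ of size $\hat\gamma_k(v)$. A paired-dominating set of a graph $H$ is a dominating set $D$ of $H$ such that $H[D]$ has a perfect matching. $\hat\gamma_p(v)$ is the minimum size of a paired-dominating set of $\hat G(v)$ (taken to be $\infty$ if none exists), and $\hat D_p(v)$ is the family of paired-dominating sets of $\hat G(v)$ of size $\hat\gamma_p(v)$. Finally $\widehat{mty}_{pr}(v)=1$ if $\hat D_p(v)\cap\hat D_0(v)=\emptyset$ and $\widehat{mty}_{pr}(v)=0$ otherwise. -}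

module Defs where

open import Data.Nat using (ℕ; zero; suc; _+_; _*_; _≤_)
open import Data.Bool using (Bool; true; false; _∧_; not; if_then_else_)
open import Data.Maybe using (Maybe; just; nothing)
open import Data.Product using (Σ; ∃; _×_; _,_)
open import Data.Sum using (_⊎_)
open import Data.Empty using (⊥)
open import Data.Unit using (⊤)
open import Relation.Nullary using (¬_)
open import Relation.Binary.PropositionalEquality using (_≡_)

-- Labels of internal nodes: ⊗ (true twin), ⊙ (false twin), ⊕ (attachment)
data Label : Set where
  otimes odot oplus : Label

data DTree : Set where
  leaf : DTree
  node : Label → DTree → DTree → DTree

-- Vertices of Ĝ(v) = leaves of the subtree rooted at v.
data Leaf : DTree → Set where
  here  : Leaf leaf
  left  : ∀ {lab l r} → Leaf l → Leaf (node lab l r)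
  right : ∀ {lab l r} → Leaf r → Leaf (node lab l r)

TS : (t : DTree) → Leaf t → Set
TS leaf here = ⊤
TS (node oplus l r) (left x) = TS l x
TS (node oplus l r) (right x) = ⊥
TS (node otimes l r) (left x) = TS l x
TS (node otimes l r) (right x) = TS r x
TS (node odot l r) (left x) = TS l x
TS (node odot l r) (right x) = TS r x

Joins : Label → Set
Joins otimes = ⊤
Joins odot = ⊥
Joins oplus = ⊤

Adj : (t : DTree) → Leaf t → Leaf t → Set
Adj leaf here here = ⊥
Adj (node lab l r) (left x) (left y) = Adj l x y
Adj (node lab l r) (right x) (right y) = Adj r x y
Adj (node lab l r) (left x) (right y) = Joins lab × TS l x × TS r y
Adj (node lab l r) (right x) (left y) = Joins lab × TS l y × TS r x

Subset : DTree → Set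
Subset t = Leaf t → Bool

size : (t : DTree) → Subset t → ℕ
size leaf S = if S here then 1 else 0
size (node lab l r) S = size l (λ x → S (left x)) + size r (λ x → S (right x))

_∈_ : ∀ {t} → Leaf t → Subset t → Set
x ∈ S = S x ≡ true

InClosedNbhd : (t : DTree) → Subset t → Leaf t → Set
InClosedNbhd t S x = ∃ λ y → y ∈ S × (y ≡ x ⊎ Adj t y x)

-- Ĝ(v)[A] has a perfect matching: a fixed-point-free (Adj is irreflexive)
-- involution M on A pairing adjacent vertices.
HasPerfectMatching : (t : DTree) → Subset t → Set
HasPerfectMatching t A =
  Σ (Leaf t → Leaf t) λ M → ∀ x → x ∈ A → (M x ∈ A) × Adj t x (M x) × (M (M x) ≡ x)

_∖_ : ∀ {t} → Subset t → Subset t → Subset t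
(S ∖ X) x = S x ∧ not (X x)

Admissible : (t : DTree) → ℕ → Subset t → Set
Admissible t k S =
  (∀ x → ¬ TS t x → InClosedNbhd t S x) ×
  Σ (Subset t) λ X → (∀ x → x ∈ X → (x ∈ S × TS t x)) × size t X ≡ k
                     × HasPerfectMatching t (S ∖ X)

PairedDominating : (t : DTree) → Subset t → Set
PairedDominating t S = (∀ x → InClosedNbhd t S x) × HasPerfectMatching t S

IsMinimum : (t : DTree) → (Subset t → Set) → Subset t → Set
IsMinimum t P S = P S × (∀ S' → P S' → size t S ≤ size t S')

-- "m is the minimum of |S| over S satisfying P", with nothing = ∞ (no such S)
MinSize : (t : DTree) → (Subset t → Set) → Maybe ℕ → Set
MinSize t P (just m) = (Σ (Subset t) λ S → P S × size t S ≡ m) × (∀ S → P S → m ≤ size t S)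
MinSize t P nothing = ∀ S → ¬ P S

Gamma : (t : DTree) → ℕ → Maybe ℕ → Set
Gamma t k g = MinSize t (Admissible t k) g

GammaP : (t : DTree) → Maybe ℕ → Set
GammaP t g = MinSize t (PairedDominating t) g

DpMeetsD0 : DTree → Set
DpMeetsD0 t = ∃ λ S → IsMinimum t (PairedDominating t) S × IsMinimum t (Admissible t 0) S

Mty : DTree → ℕ → Set
Mty t m = (m ≡ 1 × ¬ DpMeetsD0 t) ⊎ (m ≡ 0 × DpMeetsD0 t)

_+∞_ : Maybe ℕ → Maybe ℕ → Maybe ℕ
just a +∞ just b = just (a + b)
_ +∞ _ = nothing

-- At a ⊙ node Ĝ(v) is the disjoint union of Ĝ(v_l) and Ĝ(v_r), so its paired-dominating sets
-- are exactly the unions of paired-dominating sets of the two sides.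
-- At a ⊗ or ⊕ node every vertex of TS(v) lies in TS(v_l) or TS(v_r), and these two sets are
-- completely joined. A set S counted by γ̂₀(v) has a perfect matching and dominates everything
-- outside TS(v). If S contains all of TS(v_l) or all of TS(v_r) it already dominates TS(v);
-- otherwise adding one missing vertex of each side adds a matched edge that dominates it.
-- Hence γ̂₀(v) ≤ γ̂_p(v) ≤ γ̂₀(v) + 2, and as both are sizes of sets with a perfect matching they
-- are even, so γ̂_p(v) = γ̂₀(v) exactly when D̂_p(v) and D̂₀(v) meet.
module Submission where

open import Defs
open import Data.Bool using (Bool; true; false; _∧_; not; if_then_else_)
open import Data.Bool.Properties as Bool using (¬-not; ∧-identityʳ)
open import Data.Empty using (⊥)
open import Data.Maybe using (Maybe; just; nothing)
open import Data.Nat using (ℕ; zero; suc; _+_; _*_; _≤_; _<_)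
open import Data.Nat.Divisibility using (_∣_; divides; _∣0; ∣-refl; ∣m∣n⇒∣m+n)
open import Data.Nat.Properties
  using (+-comm; +-suc; +-identityʳ; +-mono-≤; ≤-antisym; ≤-reflexive; m≤m+n; ≤∧≢⇒<;
         *-cancelʳ-<; *-monoˡ-≤)
open import Data.Product as Product using (Σ; ∃; _×_; _,_; proj₁; proj₂)
open import Data.Sum as Sum using (_⊎_; inj₁; inj₂)
open import Data.Unit using (tt)
open import Function using (_∘_; id)
open import Relation.Binary.Definitions using (DecidableEquality)
open import Relation.Binary.PropositionalEquality using (_≡_; _≢_; refl; sym; trans; cong; cong₂; subst)
open import Relation.Nullary using (¬_; Dec; yes; no; does; contradiction)
open import Relation.Nullary.Decidable using (map′; _×-dec_; dec-true; dec-false)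
open import Relation.Unary using (Decidable)

private
  variable
    t : DTree
    lab : Label
    l r : DTree
    x y : Leaf t
    S : Subset t

_≟_ : DecidableEquality (Leaf t)
here ≟ here = yes refl
left x ≟ left y = map′ (cong left) (λ { refl → refl }) (x ≟ y)
left _ ≟ right _ = no λ ()
right _ ≟ left _ = no λ ()
right x ≟ right y = map′ (cong right) (λ { refl → refl }) (x ≟ y)

any? : {P : Leaf t → Set} → Decidable P → Dec (∃ P)
any? {leaf} P? = map′ (here ,_) (λ { (here , p) → p }) (P? here)
any? {node _ l r} P? with any? (P? ∘ left) | any? (P? ∘ right)
... | yes (x , p) | _ = yes (left x , p)
... | no _ | yes (y , p) = yes (right y , p)
... | no ¬l | no ¬r = no λ { (left x , p) → ¬l (x , p) ; (right y , p) → ¬r (y , p) }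

Adj-irrefl : (x : Leaf t) → ¬ Adj t x x
Adj-irrefl here ()
Adj-irrefl (left x) = Adj-irrefl x
Adj-irrefl (right x) = Adj-irrefl x

Adj-sym : (x y : Leaf t) → Adj t x y → Adj t y x
Adj-sym here here ()
Adj-sym (left x) (left y) = Adj-sym x y
Adj-sym (left _) (right _) x~y = x~y
Adj-sym (right _) (left _) x~y = x~y
Adj-sym (right x) (right y) = Adj-sym x y

Adj⇒≢ : Adj t x y → y ≢ x
Adj⇒≢ {x = x} x~y refl = Adj-irrefl x x~y

update : Leaf t → Bool → Subset t → Subset t
update here b S here = b
update (left x) b S (left y) = update x b (S ∘ left) y
update (left _) b S (right y) = S (right y)
update (right _) b S (left y) = S (left y)
update (right x) b S (right y) = update x b (S ∘ right) y

insert remove : Leaf t → Subset t → Subset t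
insert x = update x true
remove x = update x false

update-≡ : (x : Leaf t) (b : Bool) (S : Subset t) → update x b S x ≡ b
update-≡ here b S = refl
update-≡ (left x) b S = update-≡ x b (S ∘ left)
update-≡ (right x) b S = update-≡ x b (S ∘ right)

update-≢ : (x y : Leaf t) (b : Bool) (S : Subset t) → y ≢ x → update x b S y ≡ S y
update-≢ here here b S y≢x = contradiction refl y≢x
update-≢ (left x) (left y) b S y≢x = update-≢ x y b (S ∘ left) (y≢x ∘ cong left)
update-≢ (left _) (right _) b S _ = refl
update-≢ (right _) (left _) b S _ = refl
update-≢ (right x) (right y) b S y≢x = update-≢ x y b (S ∘ right) (y≢x ∘ cong right)

∈-insert⁺ : (x : Leaf t) → y ∈ S → y ∈ insert x S
∈-insert⁺ {y = y} {S = S} x y∈S with y ≟ x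
... | yes refl = update-≡ x true S
... | no y≢x = trans (update-≢ x y true S y≢x) y∈S

∈-insert-self : (x : Leaf t) (S : Subset t) → x ∈ insert x S
∈-insert-self x S = update-≡ x true S

∈-insert⁻ : (x : Leaf t) → y ≢ x → y ∈ insert x S → y ∈ S
∈-insert⁻ {y = y} {S = S} x y≢x y∈S+x = trans (sym (update-≢ x y true S y≢x)) y∈S+x

∈-remove⁺ : (x : Leaf t) → y ≢ x → y ∈ S → y ∈ remove x S
∈-remove⁺ {y = y} {S = S} x y≢x y∈S = trans (update-≢ x y false S y≢x) y∈S

∈-remove⁻ : (x : Leaf t) → y ∈ remove x S → y ≢ x × y ∈ S
∈-remove⁻ {y = y} {S = S} x y∈S-x with y ≟ x
... | yes refl = contradiction (trans (sym (update-≡ x false S)) y∈S-x) λ ()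
... | no y≢x = y≢x , trans (sym (update-≢ x y false S y≢x)) y∈S-x

size-insert : (x : Leaf t) (S : Subset t) → S x ≡ false → size t (insert x S) ≡ suc (size t S)
size-insert here S x∉S rewrite x∉S = refl
size-insert {node _ l r} (left x) S x∉S = cong (_+ size r (S ∘ right)) (size-insert x (S ∘ left) x∉S)
size-insert {node _ l r} (right x) S x∉S =
  trans (cong (size l (S ∘ left) +_) (size-insert x (S ∘ right) x∉S)) (+-suc _ _)

size-remove : (x : Leaf t) (S : Subset t) → x ∈ S → size t S ≡ suc (size t (remove x S))
size-remove here S x∈S rewrite x∈S = refl
size-remove {node _ l r} (left x) S x∈S = cong (_+ size r (S ∘ right)) (size-remove x (S ∘ left) x∈S)
size-remove {node _ l r} (right x) S x∈S =
  trans (cong (size l (S ∘ left) +_) (size-remove x (S ∘ right) x∈S)) (+-suc _ _)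

size-empty : (S : Subset t) → (∀ x → S x ≡ false) → size t S ≡ 0
size-empty {leaf} S empty rewrite empty here = refl
size-empty {node _ l r} S empty
  rewrite size-empty (S ∘ left) (empty ∘ left) = size-empty (S ∘ right) (empty ∘ right)

size≡0⇒∉ : size t S ≡ 0 → (x : Leaf t) → S x ≡ false
size≡0⇒∉ {S = S} |S|≡0 x = ¬-not λ x∈S → contradiction (trans (sym |S|≡0) (size-remove x S x∈S)) λ ()

size≡suc⇒∃∈ : ∀ {n} → size t S ≡ suc n → ∃ (_∈ S)
size≡suc⇒∃∈ {S = S} |S|≡1+n with any? (λ x → S x Bool.≟ true)
... | yes x∈S = x∈S
... | no ¬∃ with () ← trans (sym |S|≡1+n) (size-empty S λ x → ¬-not λ x∈S → ¬∃ (x , x∈S))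

IsPerfectMatching : (t : DTree) → Subset t → (Leaf t → Leaf t) → Set
IsPerfectMatching t S M = ∀ x → x ∈ S → M x ∈ S × Adj t x (M x) × M (M x) ≡ x

perfectMatching-resp : {S′ : Subset t} → (∀ x → S x ≡ S′ x) →
                       HasPerfectMatching t S → HasPerfectMatching t S′
perfectMatching-resp S≗S′ (M , M-pm) = M , λ x x∈S′ →
  let Mx∈S , x~Mx , MMx≡x = M-pm x (trans (S≗S′ x) x∈S′) in
  trans (sym (S≗S′ _)) Mx∈S , x~Mx , MMx≡x

module _ {M : Leaf t → Leaf t} (M-pm : IsPerfectMatching t S M) where

  remove-pair-matching : (x : Leaf t) → x ∈ S → IsPerfectMatching t (remove (M x) (remove x S)) M
  remove-pair-matching x x∈S y y∈S″
    with y≢Mx , y∈S′ ← ∈-remove⁻ (M x) y∈S″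
    with y≢x , y∈S ← ∈-remove⁻ x y∈S′
    with My∈S , y~My , MMy≡y ← M-pm y y∈S =
    ∈-remove⁺ (M x) My≢Mx (∈-remove⁺ x My≢x My∈S) , y~My , MMy≡y
    where
    My≢x : M y ≢ x
    My≢x My≡x = y≢Mx (trans (sym MMy≡y) (cong M My≡x))
    My≢Mx : M y ≢ M x
    My≢Mx My≡Mx = y≢x (trans (sym MMy≡y) (trans (cong M My≡Mx) (proj₂ (proj₂ (M-pm x x∈S)))))

  remove-pair-size : (x : Leaf t) → x ∈ S → size t S ≡ 2 + size t (remove (M x) (remove x S))
  remove-pair-size x x∈S = trans (size-remove x S x∈S) (cong suc (size-remove (M x) (remove x S) Mx∈S-x))
    where
    Mx∈S-x : M x ∈ remove x S
    Mx∈S-x = ∈-remove⁺ x (Adj⇒≢ (proj₁ (proj₂ (M-pm x x∈S)))) (proj₁ (M-pm x x∈S))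

perfectMatching⇒even : ∀ n → size t S ≡ n → HasPerfectMatching t S → 2 ∣ n
perfectMatching⇒even zero _ _ = 2 ∣0
perfectMatching⇒even (suc n) |S|≡1+n (M , M-pm)
  with x , x∈S ← size≡suc⇒∃∈ |S|≡1+n
  -- matching refl makes n = suc |S″| for the smaller set S″, so the recursion is structural
  with refl ← trans (sym |S|≡1+n) (remove-pair-size M-pm x x∈S) =
  ∣m∣n⇒∣m+n ∣-refl (perfectMatching⇒even _ refl (M , remove-pair-matching M-pm x x∈S))

even-gap : ∀ {m n} → 2 ∣ m → 2 ∣ n → m < n → m + 2 ≤ n
even-gap (divides p refl) (divides q refl) p*2<q*2 =
  subst (_≤ q * 2) (+-comm 2 (p * 2)) (*-monoˡ-≤ 2 (*-cancelʳ-< 2 p q p*2<q*2))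

module _ {M : Leaf t → Leaf t} (M-pm : IsPerfectMatching t S M)
         {a b : Leaf t} (a∉S : S a ≡ false) (b∉S : S b ≡ false) (a~b : Adj t a b) where

  private
    rematch : Leaf t → Leaf t
    rematch z = if does (z ≟ a) then b else if does (z ≟ b) then a else M z

    rematch-a : rematch a ≡ b
    rematch-a rewrite dec-true (a ≟ a) refl = refl

    rematch-b : rematch b ≡ a
    rematch-b rewrite dec-false (b ≟ a) (Adj⇒≢ a~b) | dec-true (b ≟ b) refl = refl

    rematch-other : ∀ {z} → z ≢ a → z ≢ b → rematch z ≡ M z
    rematch-other {z} z≢a z≢b rewrite dec-false (z ≟ a) z≢a | dec-false (z ≟ b) z≢b = refl

    S⁺ : Subset t
    S⁺ = insert b (insert a S)

    ∈∉⇒≢ : ∀ {z w} → z ∈ S → S w ≡ false → z ≢ w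
    ∈∉⇒≢ z∈S w∉S refl = contradiction (trans (sym w∉S) z∈S) λ ()

    partner : ∀ {z w} → rematch z ≡ w → w ∈ S⁺ → Adj t z w → rematch w ≡ z →
              rematch z ∈ S⁺ × Adj t z (rematch z) × rematch (rematch z) ≡ z
    partner refl w∈S⁺ z~w rematch-w≡z = w∈S⁺ , z~w , rematch-w≡z

  insert-edge-matching : HasPerfectMatching t S⁺
  insert-edge-matching = rematch , rematch-pm
    where
    rematch-pm : IsPerfectMatching t S⁺ rematch
    rematch-pm z z∈S⁺ = by-cases (z ≟ a) (z ≟ b)
      where
      by-cases : Dec (z ≡ a) → Dec (z ≡ b) →
                 rematch z ∈ S⁺ × Adj t z (rematch z) × rematch (rematch z) ≡ z
      by-cases (yes refl) _ = partner rematch-a (∈-insert-self b (insert a S)) a~b rematch-b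
      by-cases (no _) (yes refl) =
        partner rematch-b (∈-insert⁺ b (∈-insert-self a S)) (Adj-sym a b a~b) rematch-a
      by-cases (no z≢a) (no z≢b)
        with Mz∈S , z~Mz , MMz≡z ← M-pm z (∈-insert⁻ a z≢a (∈-insert⁻ b z≢b z∈S⁺)) =
        partner (rematch-other z≢a z≢b) (∈-insert⁺ b (∈-insert⁺ a Mz∈S)) z~Mz
                (trans (rematch-other (∈∉⇒≢ Mz∈S a∉S) (∈∉⇒≢ Mz∈S b∉S)) MMz≡z)

none-missing : {C : Leaf t → Set} → ¬ (∃ λ c → C c × S c ≡ false) → ∀ {c} → C c → c ∈ S
none-missing ∄c c∈C = ¬-not λ c∉S → ∄c (_ , c∈C , c∉S)

covered-side-dominates : {A B : Leaf t → Set} → (∀ {a b} → A a → B b → Adj t a b) →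
                         ∃ A → (∀ {a} → A a → a ∈ S) → ∀ z → A z ⊎ B z → InClosedNbhd t S z
covered-side-dominates _ _ A⊆S z (inj₁ z∈A) = z , A⊆S z∈A , inj₁ refl
covered-side-dominates A~B (a₀ , a₀∈A) A⊆S z (inj₂ z∈B) = a₀ , A⊆S a₀∈A , inj₂ (A~B a₀∈A z∈B)

extend-to-dominate-biclique :
  {A B : Leaf t → Set} → Decidable A → Decidable B → ∃ A → ∃ B → (∀ {a b} → A a → B b → Adj t a b) →
  HasPerfectMatching t S →
  Σ (Subset t) λ P → HasPerfectMatching t P × (∀ {x} → x ∈ S → x ∈ P) ×
                     (∀ z → A z ⊎ B z → InClosedNbhd t P z) × size t P ≤ size t S + 2
extend-to-dominate-biclique {t = t} {S = S} {A = A} {B = B} A? B? ∃A ∃B A~B (M , M-pm)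
  with any? (λ a → A? a ×-dec (S a Bool.≟ false)) | any? (λ b → B? b ×-dec (S b Bool.≟ false))
... | yes (a , a∈A , a∉S) | yes (b , b∈B , b∉S) =
  insert b (insert a S) , insert-edge-matching M-pm a∉S b∉S (A~B a∈A b∈B) ,
  ∈-insert⁺ b ∘ ∈-insert⁺ a , dominated , ≤-reflexive |S⁺|≡|S|+2
  where
  b∉S+a : insert a S b ≡ false
  b∉S+a = trans (update-≢ a b true S (Adj⇒≢ (A~B a∈A b∈B))) b∉S
  dominated : ∀ z → A z ⊎ B z → InClosedNbhd t (insert b (insert a S)) z
  dominated z (inj₁ z∈A) = b , ∈-insert-self b (insert a S) , inj₂ (Adj-sym z b (A~B z∈A b∈B))
  dominated z (inj₂ z∈B) = a , ∈-insert⁺ b (∈-insert-self a S) , inj₂ (A~B a∈A z∈B)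
  |S⁺|≡|S|+2 : size t (insert b (insert a S)) ≡ size t S + 2
  |S⁺|≡|S|+2 = trans (size-insert b (insert a S) b∉S+a)
                     (trans (cong suc (size-insert a S a∉S)) (+-comm 2 (size t S)))
... | no ∄a | _ =
  S , (M , M-pm) , (λ x∈S → x∈S) , covered-side-dominates A~B ∃A (none-missing ∄a) , m≤m+n _ 2
... | yes _ | no ∄b =
  S , (M , M-pm) , (λ x∈S → x∈S) ,
  (λ z → covered-side-dominates (λ {b} {a} b∈B a∈A → Adj-sym a b (A~B a∈A b∈B))
                                 ∃B (none-missing ∄b) z ∘ Sum.swap) ,
  m≤m+n _ 2

admissible₀⇒perfectMatching : Admissible t 0 S → HasPerfectMatching t S
admissible₀⇒perfectMatching {S = S} (_ , X , _ , |X|≡0 , S∖X-pm) = perfectMatching-resp S∖X≗S S∖X-pm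
  where
  S∖X≗S : ∀ x → (S ∖ X) x ≡ S x
  S∖X≗S x = trans (cong (λ b → S x ∧ not b) (size≡0⇒∉ |X|≡0 x)) (∧-identityʳ (S x))

pairedDominating⇒admissible₀ : PairedDominating t S → Admissible t 0 S
pairedDominating⇒admissible₀ {t} {S} (dominating , S-pm) =
  (λ x _ → dominating x) , (λ _ → false) , (λ _ ()) , size-empty {t} _ (λ _ → refl) ,
  perfectMatching-resp (λ x → sym (∧-identityʳ (S x))) S-pm

gammaP-unbounded : Gamma t 0 nothing → GammaP t nothing
gammaP-unbounded ∄S S S-pd = ∄S S (pairedDominating⇒admissible₀ S-pd)

gammaP-if-meets : ∀ {n} → Gamma t 0 (just n) → DpMeetsD0 t → GammaP t (just n)
gammaP-if-meets {t} ((S₀ , S₀-adm , |S₀|≡n) , min₀) (S , (S-pd , _) , (S-adm , S-min)) =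
  (S , S-pd , ≤-antisym (subst (size t S ≤_) |S₀|≡n (S-min S₀ S₀-adm)) (min₀ S S-adm)) ,
  λ S′ S′-pd → min₀ S′ (pairedDominating⇒admissible₀ S′-pd)

gammaP-if-disjoint :
  ∀ {n} → Gamma t 0 (just n) → ¬ DpMeetsD0 t →
  (∀ S → Admissible t 0 S → Σ (Subset t) λ P → PairedDominating t P × size t P ≤ size t S + 2) →
  GammaP t (just (n + 2))
gammaP-if-disjoint {t} {n} ((S₀ , S₀-adm , |S₀|≡n) , min₀) disjoint extend
  with P , P-pd , |P|≤|S₀|+2 ← extend S₀ S₀-adm =
  (P , P-pd , ≤-antisym (subst (λ k → size t P ≤ k + 2) |S₀|≡n |P|≤|S₀|+2) (lower P P-pd)) , lower
  where
  n-even : 2 ∣ n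
  n-even = perfectMatching⇒even n |S₀|≡n (admissible₀⇒perfectMatching S₀-adm)
  lower : ∀ S → PairedDominating t S → n + 2 ≤ size t S
  lower S S-pd =
    even-gap n-even (perfectMatching⇒even _ refl (proj₂ S-pd)) (≤∧≢⇒< (min₀ S S-adm) n≢|S|)
    where
    S-adm = pairedDominating⇒admissible₀ S-pd
    n≢|S| : n ≢ size t S
    n≢|S| n≡|S| = disjoint
      (S , (S-pd , λ S′ S′-pd →
                     subst (_≤ size t S′) n≡|S| (min₀ S′ (pairedDominating⇒admissible₀ S′-pd))) ,
           (S-adm , λ S′ S′-adm → subst (_≤ size t S′) n≡|S| (min₀ S′ S′-adm)))

TS? : (t : DTree) → Decidable (TS t)
TS? leaf here = yes tt
TS? (node otimes l r) (left x) = TS? l x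
TS? (node otimes l r) (right y) = TS? r y
TS? (node odot l r) (left x) = TS? l x
TS? (node odot l r) (right y) = TS? r y
TS? (node oplus l r) (left x) = TS? l x
TS? (node oplus l r) (right _) = no λ ()

twin : (t : DTree) → ∃ (TS t)
twin leaf = here , tt
twin (node otimes l r) = Product.map left id (twin l)
twin (node odot l r) = Product.map left id (twin l)
twin (node oplus l r) = Product.map left id (twin l)

Twinˡ Twinʳ : Leaf (node lab l r) → Set
Twinˡ {l = l} (left x) = TS l x
Twinˡ (right _) = ⊥
Twinʳ (left _) = ⊥
Twinʳ {r = r} (right y) = TS r y

Twinˡ? : Decidable (Twinˡ {lab} {l} {r})
Twinˡ? {l = l} (left x) = TS? l x
Twinˡ? (right _) = no λ ()

Twinʳ? : Decidable (Twinʳ {lab} {l} {r})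
Twinʳ? (left _) = no λ ()
Twinʳ? {r = r} (right y) = TS? r y

twin-split : (z : Leaf (node lab l r)) → TS (node lab l r) z → Twinˡ z ⊎ Twinʳ z
twin-split {otimes} (left _) = inj₁
twin-split {otimes} (right _) = inj₂
twin-split {odot} (left _) = inj₁
twin-split {odot} (right _) = inj₂
twin-split {oplus} (left _) = inj₁
twin-split {oplus} (right _) ()

twins-adjacent : Joins lab → ∀ {a b : Leaf (node lab l r)} →
                 Twinˡ a → Twinʳ b → Adj (node lab l r) a b
twins-adjacent joined {left _} {right _} a∈TS b∈TS = joined , a∈TS , b∈TS
twins-adjacent joined {left _} {left _} _ ()
twins-adjacent joined {right _} ()

extend-to-pairedDominating :
  Joins lab → Admissible (node lab l r) 0 S →
  Σ (Subset (node lab l r)) λ P →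
    PairedDominating (node lab l r) P × size (node lab l r) P ≤ size (node lab l r) S + 2
extend-to-pairedDominating {l = l} {r = r} joined S-adm@(outside-dominated , _)
  with P , P-pm , S⊆P , twins-dominated , |P|≤ ←
       extend-to-dominate-biclique Twinˡ? Twinʳ? (Product.map left id (twin l)) (Product.map right id (twin r))
         (λ {a} {b} → twins-adjacent joined {a} {b}) (admissible₀⇒perfectMatching S-adm) =
  P , (dominated , P-pm) , |P|≤
  where
  dominated : ∀ z → InClosedNbhd _ P z
  dominated z with TS? _ z
  ... | yes z∈TS = twins-dominated z (twin-split z z∈TS)
  ... | no z∉TS with y , y∈S , y~z ← outside-dominated z z∉TS = y , S⊆P y∈S , y~z

merge : Subset l → Subset r → Subset (node lab l r)
merge Sˡ Sʳ (left x) = Sˡ x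
merge Sˡ Sʳ (right y) = Sʳ y

pairedDominating-merge : {Sˡ : Subset l} {Sʳ : Subset r} →
  PairedDominating l Sˡ → PairedDominating r Sʳ → PairedDominating (node odot l r) (merge Sˡ Sʳ)
pairedDominating-merge {l} {r} {Sˡ} {Sʳ} (domˡ , Mˡ , Mˡ-pm) (domʳ , Mʳ , Mʳ-pm) = dom , M , M-pm
  where
  dom : ∀ z → InClosedNbhd (node odot l r) (merge Sˡ Sʳ) z
  dom (left x) with y , y∈S , y~x ← domˡ x = left y , y∈S , Sum.map₁ (cong left) y~x
  dom (right x) with y , y∈S , y~x ← domʳ x = right y , y∈S , Sum.map₁ (cong right) y~x
  M : Leaf (node odot l r) → Leaf (node odot l r)
  M (left x) = left (Mˡ x)
  M (right y) = right (Mʳ y)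
  M-pm : IsPerfectMatching (node odot l r) (merge Sˡ Sʳ) M
  M-pm (left x) x∈S = Product.map₂ (Product.map₂ (cong left)) (Mˡ-pm x x∈S)
  M-pm (right y) y∈S = Product.map₂ (Product.map₂ (cong right)) (Mʳ-pm y y∈S)

fromLeft : Leaf l → Leaf (node lab l r) → Leaf l
fromLeft _ (left x) = x
fromLeft d (right _) = d

fromRight : Leaf r → Leaf (node lab l r) → Leaf r
fromRight d (left _) = d
fromRight _ (right y) = y

pairedDominating-left : PairedDominating (node odot l r) S → PairedDominating l (S ∘ left)
pairedDominating-left {l} {r} {S} (dom , M , M-pm) = dominated ∘ dom ∘ left , Mˡ , Mˡ-pm
  where
  dominated : ∀ {x} → InClosedNbhd (node odot l r) S (left x) → InClosedNbhd l (S ∘ left) x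
  dominated (left y , y∈S , inj₁ refl) = y , y∈S , inj₁ refl
  dominated (left y , y∈S , inj₂ y~x) = y , y∈S , inj₂ y~x
  dominated (right _ , _ , inj₁ ())
  dominated (right _ , _ , inj₂ (() , _))
  Mˡ : Leaf l → Leaf l
  Mˡ x = fromLeft x (M (left x))
  Mˡ-pm : IsPerfectMatching l (S ∘ left) Mˡ
  Mˡ-pm x x∈S with M (left x) | M-pm (left x) x∈S
  ... | left y | y∈S , x~y , MMx≡x = y∈S , x~y , cong (fromLeft y) MMx≡x
  ... | right _ | _ , (() , _) , _

pairedDominating-right : PairedDominating (node odot l r) S → PairedDominating r (S ∘ right)
pairedDominating-right {l} {r} {S} (dom , M , M-pm) = dominated ∘ dom ∘ right , Mʳ , Mʳ-pm
  where
  dominated : ∀ {x} → InClosedNbhd (node odot l r) S (right x) → InClosedNbhd r (S ∘ right) x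
  dominated (right y , y∈S , inj₁ refl) = y , y∈S , inj₁ refl
  dominated (right y , y∈S , inj₂ y~x) = y , y∈S , inj₂ y~x
  dominated (left _ , _ , inj₁ ())
  dominated (left _ , _ , inj₂ (() , _))
  Mʳ : Leaf r → Leaf r
  Mʳ x = fromRight x (M (right x))
  Mʳ-pm : IsPerfectMatching r (S ∘ right) Mʳ
  Mʳ-pm x x∈S with M (right x) | M-pm (right x) x∈S
  ... | right y | y∈S , x~y , MMx≡x = y∈S , x~y , cong (fromRight y) MMx≡x
  ... | left _ | _ , (() , _) , _

gammaP-⊙ : (a b : Maybe ℕ) → GammaP l a → GammaP r b → GammaP (node odot l r) (a +∞ b)
gammaP-⊙ (just _) (just _) ((Sˡ , Sˡ-pd , |Sˡ|≡a) , minˡ) ((Sʳ , Sʳ-pd , |Sʳ|≡b) , minʳ) =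
  (merge Sˡ Sʳ , pairedDominating-merge Sˡ-pd Sʳ-pd , cong₂ _+_ |Sˡ|≡a |Sʳ|≡b) ,
  λ S S-pd → +-mono-≤ (minˡ _ (pairedDominating-left S-pd)) (minʳ _ (pairedDominating-right S-pd))
gammaP-⊙ nothing _ noneˡ _ S S-pd = noneˡ _ (pairedDominating-left S-pd)
gammaP-⊙ (just _) nothing _ noneʳ S S-pd = noneʳ _ (pairedDominating-right S-pd)

joins : lab ≡ otimes ⊎ lab ≡ oplus → Joins lab
joins (inj₁ refl) = tt
joins (inj₂ refl) = tt

lemma2 : (lab : Label) (l r : DTree) →
    (lab ≡ odot → (a b : Maybe ℕ) → GammaP l a → GammaP r b →
      GammaP (node lab l r) (a +∞ b))
    ×
    ((lab ≡ otimes ⊎ lab ≡ oplus) → (g0 : Maybe ℕ) (m : ℕ) →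
      Gamma (node lab l r) 0 g0 → Mty (node lab l r) m →
      GammaP (node lab l r) (g0 +∞ just (2 * m)))
lemma2 lab l r = (λ { refl → gammaP-⊙ }) , gammaP-joined
  where
  gammaP-joined : (lab ≡ otimes ⊎ lab ≡ oplus) → (g0 : Maybe ℕ) (m : ℕ) →
                  Gamma (node lab l r) 0 g0 → Mty (node lab l r) m →
                  GammaP (node lab l r) (g0 +∞ just (2 * m))
  gammaP-joined _ nothing _ γ₀ _ = gammaP-unbounded γ₀
  gammaP-joined _ (just n) _ γ₀ (inj₂ (refl , meets)) =
    subst (GammaP _ ∘ just) (sym (+-identityʳ n)) (gammaP-if-meets γ₀ meets)
  gammaP-joined joined (just n) _ γ₀ (inj₁ (refl , disjoint)) =
    gammaP-if-disjoint γ₀ disjoint (λ _ → extend-to-pairedDominating (joins joined))
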